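{- $\mathfrak{a}(\mathcal{NC})=\omega$.
   Context: For $A\subseteq\omega\times\omega$ and $n<\omega$ let $A(n)=\{m<\omega:(n,m)\in A\}$. A family $\mathcal{X}\subseteq[\omega]^\omega$ is centered if $\bigcap F$ is infinite for every finite nonempty $F\subseteq\mathcal{X}$. $\mathcal{NC}=\{A\subseteq\omega\times\omega:\ \text{for every } X\in[\omega]^\omega \text{ the family } \{A(n):n\in X\}\text{ is not centered}\}$ is an ideal on $\omega\times\omega$, $\mathcal{NC}^+=\mathcal{P}(\omega\times\omega)\setminus\mathcal{NC}$. Sets $A,B\in\mathcal{NC}^+$ are $\mathcal{NC}$-almost disjoint if $A\cap B\in\mathcal{NC}$; an $\mathcal{NC}$-mad family is a subfamily of $\mathcal{NC}^+$ of pairwise $\mathcal{NC}$-almost disjoint sets, maximal with this property. $\mathfrak{a}(\mathcal{NC})$ is the least size of an infinite $\mathcal{NC}$-mad family. -}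

module Defs where

open import Data.Nat using (ℕ; _≤_)
open import Data.Product using (_×_; _,_; ∃; Σ)
open import Data.List using (List; [])
open import Data.List.Relation.Unary.All using (All)
open import Relation.Nullary using (¬_)
open import Relation.Binary.PropositionalEquality using (_≡_; _≢_)
open import Data.Empty using (⊥)

SubsetN : Set₁
SubsetN = ℕ → Set

SubsetNN : Set₁
SubsetNN = ℕ → ℕ → Set    -- A n m  means  (n , m) ∈ A ; so A n is the section A(n)

Infinite : SubsetN → Set
Infinite X = ∀ (k : ℕ) → ∃ λ m → k ≤ m × X m

Centered : SubsetNN → SubsetN → Set
Centered A X = ∀ (ns : List ℕ) → ns ≢ [] → All X ns →
               Infinite (λ m → All (λ n → A n m) ns)

NC : SubsetNN → Set₁
NC A = ∀ (X : SubsetN) → Infinite X → ¬ Centered A X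

NC⁺ : SubsetNN → Set₁
NC⁺ A = ¬ NC A

_∩_ : SubsetNN → SubsetNN → SubsetNN
(A ∩ B) n m = A n m × B n m

NC-AD : SubsetNN → SubsetNN → Set₁
NC-AD A B = NC (A ∩ B)

IsNCMadSeq : (ℕ → SubsetNN) → Set₁
IsNCMadSeq 𝒜 =
    (∀ i → NC⁺ (𝒜 i))
  × (∀ i j → i ≢ j → NC-AD (𝒜 i) (𝒜 j))
  × (∀ (B : SubsetNN) → NC⁺ B → ¬ (∀ i → NC-AD (𝒜 i) B))

-- Let A₀(n) be the multiples of 2ⁿ and, for n > i, let A_{i+1}(n) be the numbers of 2-adic valuation
-- exactly i. Each Aᵢ is NC-positive, and they are pairwise NC-almost disjoint because valuations are
-- unique. For maximality take B and an infinite X with {B(n) : n ∈ X} centered. As B ∩ A₀ ∈ NC, some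
-- finite F ⊆ X has ⋂_{n ∈ F} (B(n) ∩ A₀(n)) finite; adding F to any finite subfamily shows that
-- {B(n) ∩ V : n ∈ X} is centered, where V, the numbers of valuation below Σ F, is a finite union of
-- valuation classes. Classically, centeredness on a finite union passes to one piece, the class of
-- some valuation i, and then B ∩ A_{i+1} is NC-positive.

module Submission where

open import Defs
open import Level using (0ℓ; lift; lower)
open import Axiom.ExcludedMiddle using (ExcludedMiddle)
open import Axiom.DoubleNegationElimination using (DoubleNegationElimination; em⇒dne)
open import Function using (_∘_; id)
open import Data.Product using (∃; Σ; _×_; _,_; proj₁)
open import Data.Sum using (_⊎_; inj₁; inj₂; [_,_]′)
import Data.Sum as Sum
open import Data.Unit using (⊤; tt)
open import Data.List using (List; []; _∷_; _++_)
open import Data.List.Properties using (++-conicalˡ)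
open import Data.List.Relation.Unary.All using (All; []; _∷_; lookupAny)
import Data.List.Relation.Unary.All as All
open import Data.List.Relation.Unary.All.Properties using (++⁺; ++⁻; ¬All⇒Any¬)
open import Data.Nat using (ℕ; zero; suc; _+_; _*_; _^_; _∸_; _≤_; _<_; _⊔_; NonZero; >-nonZero; z<s)
open import Data.Nat.Properties
open import Data.Nat.Divisibility using (_∣_; divides; _∣?_; ∣-trans; 1∣_; ∣1⇒≡1; m∣m*n; n∣m*n; ∣m+n∣m⇒∣n; *-cancelʳ-∣)
open import Data.Nat.ListAction using (sum)
open import Relation.Nullary using (¬_; yes; no; contradiction)
open import Relation.Nullary.Decidable using (map′)
open import Relation.Binary.Definitions using (tri<; tri≈; tri>)
open import Relation.Binary.PropositionalEquality using (_≡_; _≢_; refl; sym; trans; cong)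

variable
  A B : SubsetNN
  X S S' R : SubsetN
  ns ns₀ : List ℕ
  i j k m p : ℕ

Bounded : SubsetN → Set
Bounded S = ∃ λ k → ∀ m → k ≤ m → ¬ S m

bounded-⊆ : (∀ {m} → S m → R m) → Bounded R → Bounded S
bounded-⊆ S⊆R (k , empty) = k , λ m k≤m → empty m k≤m ∘ S⊆R

All-≤-sum : ∀ ns → All (_≤ sum ns) ns
All-≤-sum []       = []
All-≤-sum (n ∷ ns) = m≤m+n n (sum ns) ∷ All.map (λ n'≤ → ≤-trans n'≤ (m≤n+m (sum ns) n)) (All-≤-sum ns)

infinite⇒nonempty : Infinite X → ∃ X
infinite⇒nonempty X-inf = let n , _ , xn = X-inf 0 in n , xn

>-infinite : ∀ i → Infinite (i <_)
>-infinite i k = k ⊔ suc i , m≤m⊔n k (suc i) , m≤n⊔m k (suc i)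

infinite-∩> : ∀ i → Infinite X → Infinite (λ n → X n × i < n)
infinite-∩> i X-inf k with X-inf (k ⊔ suc i)
... | n , k⊔i<n , xn = n , ≤-trans (m≤m⊔n k (suc i)) k⊔i<n , xn , ≤-trans (m≤n⊔m k (suc i)) k⊔i<n

∣-infinite : ∀ d .{{_ : NonZero d}} → Infinite (d ∣_)
∣-infinite d k = d * k , m≤n*m k d , m∣m*n k

^-monoʳ-∣ : ∀ p → i ≤ j → p ^ i ∣ p ^ j
^-monoʳ-∣ {i = i} {j = j} p i≤j = divides (p ^ (j ∸ i))
  (trans (cong (p ^_) (sym (m∸n+n≡m i≤j))) (^-distribˡ-+-* p (j ∸ i) i))

_^_∥_ : ℕ → ℕ → ℕ → Set
p ^ i ∥ m = p ^ i ∣ m × ¬ p ^ suc i ∣ m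

∥⇒∤ : p ^ i ∥ m → i < j → ¬ p ^ j ∣ m
∥⇒∤ {p = p} (_ , ∤m) i<j pʲ∣m = ∤m (∣-trans (^-monoʳ-∣ p i<j) pʲ∣m)

∥-unique : p ^ i ∥ m → p ^ j ∥ m → i ≡ j
∥-unique {i = i} {j = j} pⁱ∥m pʲ∥m with <-cmp i j
... | tri< i<j _ _ = contradiction (proj₁ pʲ∥m) (∥⇒∤ pⁱ∥m i<j)
... | tri≈ _ i≡j _ = i≡j
... | tri> _ _ j<i = contradiction (proj₁ pⁱ∥m) (∥⇒∤ pʲ∥m j<i)

∥-infinite : ∀ p i → 1 < p → Infinite (p ^ i ∥_)
∥-infinite p i 1<p k = (k * p + 1) * p ^ i , k≤m , pⁱ∣m , pⁱ⁺¹∤m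
  where
  instance
    p≢0 : NonZero p
    p≢0 = >-nonZero (<-trans z<s 1<p)
    pⁱ≢0 : NonZero (p ^ i)
    pⁱ≢0 = m^n≢0 p i
  k≤m : k ≤ (k * p + 1) * p ^ i
  k≤m = ≤-trans (≤-trans (m≤m*n k p) (m≤m+n (k * p) 1)) (m≤m*n _ (p ^ i))
  pⁱ∣m : p ^ i ∣ (k * p + 1) * p ^ i
  pⁱ∣m = n∣m*n (k * p + 1)
  pⁱ⁺¹∤m : ¬ p ^ suc i ∣ (k * p + 1) * p ^ i
  pⁱ⁺¹∤m pⁱ⁺¹∣m = <⇒≢ 1<p (sym (∣1⇒≡1 (∣m+n∣m⇒∣n (*-cancelʳ-∣ (p ^ i) pⁱ⁺¹∣m) (n∣m*n k))))

∤⇒∥-below : ∀ n → ¬ p ^ n ∣ m → ∃ λ i → i < n × p ^ i ∥ m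
∤⇒∥-below {m = m} zero ∤m = contradiction (1∣ m) ∤m
∤⇒∥-below {p = p} {m = m} (suc n) ∤m with p ^ n ∣? m
... | yes pⁿ∣m = n , n<1+n n , pⁿ∣m , ∤m
... | no pⁿ∤m with ∤⇒∥-below n pⁿ∤m
...   | i , i<n , pⁱ∥m = i , m<n⇒m<1+n i<n , pⁱ∥m

¬All∣⇒∥-below-sum : ∀ ns → ¬ All (λ n → p ^ n ∣ m) ns → ∃ λ i → i < sum ns × p ^ i ∥ m
¬All∣⇒∥-below-sum {p = p} {m = m} ns ¬all
  with lookupAny (All-≤-sum ns) (¬All⇒Any¬ (λ n → p ^ n ∣? m) ns ¬all)
... | n≤sum , pⁿ∤m with ∤⇒∥-below _ pⁿ∤m
...   | i , i<n , pⁱ∥m = i , <-≤-trans i<n n≤sum , pⁱ∥m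

CenteredOn : SubsetNN → SubsetN → SubsetN → Set
CenteredOn B X S = ∀ ns → ns ≢ [] → All X ns → Infinite (λ m → All (λ n → B n m) ns × S m)

centered⇒centeredOn : Centered B X → CenteredOn B X (λ _ → ⊤)
centered⇒centeredOn c ns ns≢[] xs k with c ns ns≢[] xs k
... | m , k≤m , Bs = m , k≤m , Bs , tt

centeredOn-mono : (∀ {m} → S m → R m) → CenteredOn B X S → CenteredOn B X R
centeredOn-mono S⊆R c ns ns≢[] xs k with c ns ns≢[] xs k
... | m , k≤m , Bs , Sm = m , k≤m , Bs , S⊆R Sm

-- Enlarge each finite subfamily by ns₀: beyond k₀ its common points then avoid R.
centeredOn-avoid : CenteredOn B X S → All X ns₀ → Bounded (λ m → All (λ n → B n m) ns₀ × R m) →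
                   CenteredOn B X (λ m → S m × ¬ R m)
centeredOn-avoid {ns₀ = ns₀} c xs₀ (k₀ , empty) ns ns≢[] xs k
  with c (ns ++ ns₀) (ns≢[] ∘ ++-conicalˡ ns ns₀) (++⁺ xs xs₀) (k ⊔ k₀)
... | m , k⊔k₀≤m , Bs , Sm with ++⁻ ns Bs
... | Bns , Bns₀ = m , ≤-trans (m≤m⊔n k k₀) k⊔k₀≤m , Bns , Sm ,
                   λ Rm → empty m (≤-trans (m≤n⊔m k k₀) k⊔k₀≤m) (Bns₀ , Rm)

centeredOn⇒NC⁺ : Infinite X → CenteredOn B X S → NC⁺ ((λ n m → i < n × S m) ∩ B)
centeredOn⇒NC⁺ {X = X} {B = B} {S = S} {i = i} X-inf c nc = nc (λ n → X n × i < n) (infinite-∩> i X-inf) centered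
  where
  centered : Centered ((λ n m → i < n × S m) ∩ B) (λ n → X n × i < n)
  centered ns ns≢[] xs k with c ns ns≢[] (All.map proj₁ xs) k
  ... | m , k≤m , Bs , Sm = m , k≤m , All.zipWith (λ ((_ , i<n) , Bnm) → (i<n , Sm) , Bnm) (xs , Bs)

centered-common : Infinite S → (∀ {n m} → X n → S m → A n m) → Centered A X
centered-common S-inf S⊆A ns _ xs k with S-inf k
... | m , k≤m , Sm = m , k≤m , All.map (λ xn → S⊆A xn Sm) xs

centered-antitone : (∀ {n n' m} → n ≤ n' → A n' m → A n m) → (∀ n → Infinite (A n)) → Centered A X
centered-antitone antitone A-inf ns _ _ k with A-inf (sum ns) k
... | m , k≤m , Am = m , k≤m , All.map (λ n≤sum → antitone n≤sum Am) (All-≤-sum ns)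

eventually-empty⇒NC : (∀ {n m} → k ≤ n → ¬ A n m) → NC A
eventually-empty⇒NC {k = k} empty X X-inf c with X-inf k
... | n , k≤n , xn with c (n ∷ []) (λ ()) (xn ∷ []) 0
... | _ , _ , Anm ∷ [] = empty k≤n Anm

module Classical (em : ExcludedMiddle (Level.suc 0ℓ)) where

  em₀ : ExcludedMiddle 0ℓ
  em₀ = map′ lower lift em

  dne₀ : DoubleNegationElimination 0ℓ
  dne₀ = em⇒dne em₀

  ¬bounded⇒infinite : ¬ Bounded S → Infinite S
  ¬bounded⇒infinite ¬bounded k = dne₀ λ ¬m → ¬bounded (k , λ m k≤m Sm → ¬m (m , k≤m , Sm))

  -- Both Centered A X and CenteredOn B X S have this shape, with F ns the intersection over ns.
  ¬centered⇒bounded : {F : List ℕ → SubsetN} → ¬ (∀ ns → ns ≢ [] → All X ns → Infinite (F ns)) →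
                      ∃ λ ns → All X ns × Bounded (F ns)
  ¬centered⇒bounded ¬c = dne₀ λ ¬w → ¬c λ ns _ xs → ¬bounded⇒infinite λ b → ¬w (ns , xs , b)

  NC⁺⇒centered : NC⁺ A → Σ SubsetN λ X → Infinite X × Centered A X
  NC⁺⇒centered A⁺ = em⇒dne em λ ¬w → A⁺ λ X X-inf c → ¬w (X , X-inf , c)

  centeredOn-∪ : CenteredOn B X (λ m → S m ⊎ S' m) → CenteredOn B X S ⊎ CenteredOn B X S'
  centeredOn-∪ {B = B} {X = X} {S = S} {S' = S'} c with em₀ {CenteredOn B X S}
  ... | yes cS = inj₁ cS
  ... | no ¬cS with ¬centered⇒bounded ¬cS
  ... | _ , xs₀ , bounded = inj₂ (centeredOn-mono resolve (centeredOn-avoid c xs₀ bounded))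
    where
    resolve : ∀ {m} → (S m ⊎ S' m) × ¬ S m → S' m
    resolve (Sm⊎S'm , ¬Sm) = [ (λ Sm → contradiction Sm ¬Sm) , id ]′ Sm⊎S'm

  centeredOn-⋃ : (P : ℕ → SubsetN) → ∃ X → ∀ N → CenteredOn B X (λ m → ∃ λ i → i < N × P i m) →
                 ∃ λ i → i < N × CenteredOn B X (P i)
  centeredOn-⋃ P (x , xX) zero c with c (x ∷ []) (λ ()) (xX ∷ []) 0
  ... | _ , _ , _ , _ , () , _
  centeredOn-⋃ P X≠∅ (suc N) c with centeredOn-∪ (centeredOn-mono split c)
    where
    split : ∀ {m} → (∃ λ i → i < suc N × P i m) → (∃ λ i → i < N × P i m) ⊎ P N m
    split (i , i<1+N , Pim) = Sum.map (λ i<N → i , i<N , Pim) (λ { refl → Pim }) (m<1+n⇒m<n∨m≡n i<1+N)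
  ... | inj₂ cN = N , n<1+n N , cN
  ... | inj₁ c< with centeredOn-⋃ P X≠∅ N c<
  ...   | i , i<N , cᵢ = i , m<n⇒m<1+n i<N , cᵢ

𝒜 : ℕ → SubsetNN
𝒜 zero    n m = 2 ^ n ∣ m
𝒜 (suc i) n m = i < n × 2 ^ i ∥ m

𝒜-positive : ∀ i → NC⁺ (𝒜 i)
𝒜-positive zero nc = nc (λ _ → ⊤) (λ k → k , ≤-refl , tt)
  (centered-antitone (λ n≤n' → ∣-trans (^-monoʳ-∣ 2 n≤n')) (λ n → ∣-infinite (2 ^ n) {{m^n≢0 2 n}}))
𝒜-positive (suc i) nc = nc (i <_) (>-infinite i) (centered-common (∥-infinite 2 i ≤-refl) _,_)

𝒜-almostDisjoint : ∀ i j → i ≢ j → NC-AD (𝒜 i) (𝒜 j)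
𝒜-almostDisjoint zero    zero    0≢0 = contradiction refl 0≢0
𝒜-almostDisjoint zero    (suc j) _   = eventually-empty⇒NC λ j<n (2ⁿ∣m , _ , 2ʲ∥m) → ∥⇒∤ {i = j} 2ʲ∥m j<n 2ⁿ∣m
𝒜-almostDisjoint (suc i) zero    _   = eventually-empty⇒NC λ i<n ((_ , 2ⁱ∥m) , 2ⁿ∣m) → ∥⇒∤ {i = i} 2ⁱ∥m i<n 2ⁿ∣m
𝒜-almostDisjoint (suc i) (suc j) i+1≢j+1 = eventually-empty⇒NC {k = 0} λ _ ((_ , 2ⁱ∥m) , (_ , 2ʲ∥m)) →
  i+1≢j+1 (cong suc (∥-unique {i = i} {j = j} 2ⁱ∥m 2ʲ∥m))

module _ (em : ExcludedMiddle (Level.suc 0ℓ)) where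

  open Classical em

  𝒜-maximal : ∀ B → NC⁺ B → ¬ (∀ i → NC-AD (𝒜 i) B)
  𝒜-maximal B B⁺ ad with NC⁺⇒centered B⁺
  ... | X , X-inf , X-cent with ¬centered⇒bounded (ad 0 X X-inf)
  ... | ns₀ , xs₀ , bounded with centeredOn-⋃ (2 ^_∥_) (infinite⇒nonempty X-inf) (sum ns₀) lowValuations
    where
    lowValuations : CenteredOn B X (λ m → ∃ λ i → i < sum ns₀ × 2 ^ i ∥ m)
    lowValuations = centeredOn-mono (λ (_ , ¬all) → ¬All∣⇒∥-below-sum ns₀ ¬all)
      (centeredOn-avoid (centered⇒centeredOn X-cent) xs₀ (bounded-⊆ (λ (Bs , 2ⁿ∣m) → All.zip (2ⁿ∣m , Bs)) bounded))
  ... | i , _ , cᵢ = centeredOn⇒NC⁺ X-inf cᵢ (ad (suc i))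

corollary2p7 : ExcludedMiddle (Level.suc 0ℓ) → ∃ λ (𝒜 : ℕ → SubsetNN) → IsNCMadSeq 𝒜
corollary2p7 em = 𝒜 , 𝒜-positive , 𝒜-almostDisjoint , 𝒜-maximal em
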